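{- Let $j$ be a positive integer. Then \[ \liminf_{r\to+\infty}\frac{\mathsf{D}_j(C_2^r)}{r}\ \ge\ \log 2\,\frac{j}{\log(j+1)}, \] that is, $\mathsf{D}_j(C_2^r)\ge (1+o(1))\,\log 2\,\frac{j}{\log(j+1)}\,r$ as $r\to\infty$.
   Context: $C_2^r$ denotes the elementary abelian $2$-group of rank $r$. A sequence over a finite abelian group $G$ is a finite list of elements of $G$ (repetitions allowed); subsequences correspond to subsets of indices, are disjoint if their index sets are disjoint, and are zero-sum if their terms sum to $0$. For a positive integer $j$, $\mathsf{D}_j(G)$ is the smallest integer $\ell$ such that every sequence over $G$ of length at least $\ell$ contains $j$ pairwise disjoint non-empty zero-sum subsequences. $\log$ is the natural logarithm. -}

module Defs where

open import Data.Nat using (ℕ; zero; suc; _≤_)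
open import Data.Bool using (Bool; true; false; _xor_)
open import Data.Vec using (Vec; []; _∷_; zipWith; replicate)
open import Data.Fin using (Fin)
import Data.Fin as F
open import Data.Fin.Subset using (Subset; Nonempty; Empty; _∩_)
open import Data.Product using (Σ; _×_)
open import Relation.Binary.PropositionalEquality using (_≡_; _≢_)

C2^ : ℕ → Set
C2^ r = Vec Bool r

_⊕_ : ∀ {r} → C2^ r → C2^ r → C2^ r
_⊕_ = zipWith _xor_

𝟘 : ∀ {r} → C2^ r
𝟘 = replicate _ false

Seq : ℕ → ℕ → Set
Seq r n = Fin n → C2^ r

subsum : ∀ {r n} → Seq r n → Subset n → C2^ r
subsum {n = zero}  s []          = 𝟘
subsum {n = suc n} s (true  ∷ p) = s F.zero ⊕ subsum (λ i → s (F.suc i)) p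
subsum {n = suc n} s (false ∷ p) = subsum (λ i → s (F.suc i)) p

HasDisjointZeroSums : ∀ {r n} → ℕ → Seq r n → Set
HasDisjointZeroSums {r} {n} j s =
  Σ (Fin j → Subset n) λ S →
    (∀ i → Nonempty (S i)) ×
    (∀ i → subsum s (S i) ≡ 𝟘) ×
    (∀ i k → i ≢ k → Empty (S i ∩ S k))

Good : ℕ → ℕ → ℕ → Set
Good j r ℓ = ∀ n → ℓ ≤ n → (s : Seq r n) → HasDisjointZeroSums j s

IsDj : ℕ → ℕ → ℕ → Set
IsDj j r ℓ = Good j r ℓ × (∀ m → Good j r m → ℓ ≤ m)

module Submission where

-- Label each position of a sequence of length n by "unused" or by one of
-- j classes; call a labelling full if every class occurs.  If a sequence
-- s over C₂^r has j disjoint non-empty zero-sum subsequences, then all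
-- class sums of s vanish for some full labelling T.  For full T the class-sum
-- map (C₂^r)^n → (C₂^r)^j is a surjective homomorphism, so its kernel has
-- 2^(rn) / 2^(rj) elements.  As there are at most (j+1)^n labellings,
-- their kernels can only cover all 2^(rn) sequences if 2^(rj) ≤ (j+1)^n.
-- Taking n = D_j(C₂^r) and comparing exponents gives a·r ≤ b·D_j(C₂^r)
-- whenever (j+1)^a < 2^(jb), for every r.

open import Defs
open import Data.Nat using (ℕ; suc; _+_; _*_; _^_; _≤_; _<_)
open import Data.Product using (∃)

open import Data.Nat using (zero; _∸_; z≤n; >-nonZero)
open import Data.Nat.Properties hiding (_≟_)
open import Data.Bool using (Bool; true; false; _xor_; if_then_else_)
import Data.Bool
open import Data.Fin using (Fin; zero; suc)
import Data.Fin.Properties as Fin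
open import Data.Fin.Subset using (Subset; _∈_)
open import Data.Fin.Subset.Properties using (_∈?_; x∈p∩q⁺)
open import Data.Vec using (Vec; []; _∷_; zipWith; replicate; lookup; tabulate)
import Data.Vec
open import Data.Vec.Properties
  using ( ≡-dec; tabulate∘lookup; tabulate-cong; lookup∘tabulate; lookup-map
        ; lookup-zipWith; lookup-replicate; map-id
        ; zipWith-assoc; zipWith-comm; zipWith-identityʳ; zipWith-inverseʳ )
open import Data.Bool.Properties using (xor-assoc; xor-comm; xor-identityʳ; xor-same)
open import Data.Product using (_×_; _,_; proj₁; proj₂)
open import Function.Base using (_∘_)
open import Function.Bundles using (_⇔_; mk⇔; module Equivalence)
open import Relation.Binary.PropositionalEquality
open import Algebra.Properties.CommutativeSemigroup +-commutativeSemigroup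
  using () renaming (interchange to +-interchange)
open import Relation.Binary.Definitions using (DecidableEquality)
open import Relation.Nullary using (Dec; yes; no; does; ¬_; contradiction; _×-dec_)
open import Relation.Nullary.Decidable using (does-⇔; dec-true; dec-false)

𝟙 : {P : Set} → Dec P → ℕ
𝟙 p = if does p then 1 else 0

𝟙-⇔ : {P Q : Set} → P ⇔ Q → (p : Dec P) (q : Dec Q) → 𝟙 p ≡ 𝟙 q
𝟙-⇔ P⇔Q p q = cong (λ b → if b then 1 else 0) (does-⇔ P⇔Q p q)

𝟙-true : {P : Set} (p : Dec P) → P → 𝟙 p ≡ 1
𝟙-true p holds = cong (λ b → if b then 1 else 0) (dec-true p holds)

𝟙-false : {P : Set} (p : Dec P) → ¬ P → 𝟙 p ≡ 0
𝟙-false p fails = cong (λ b → if b then 1 else 0) (dec-false p fails)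

𝟙-mono : {P Q : Set} → (P → Q) → (p : Dec P) (q : Dec Q) → 𝟙 p ≤ 𝟙 q
𝟙-mono P→Q (no _)  q       = z≤n
𝟙-mono P→Q (yes p) (yes _) = ≤-refl
𝟙-mono P→Q (yes p) (no ¬q) = contradiction (P→Q p) ¬q

-- Additivity of a summation operator; 'σ-cong' replaces function
-- extensionality, which is not available.
record Additive {A : Set} (σ : (A → ℕ) → ℕ) : Set where
  field
    σ-cong : ∀ {f g : A → ℕ} → (∀ a → f a ≡ g a) → σ f ≡ σ g
    σ-+    : ∀ f g → σ (λ a → f a + g a) ≡ σ f + σ g
    σ-0    : σ (λ _ → 0) ≡ 0

record FinSum (A : Set) : Set₁ where
  field
    σ        : (A → ℕ) → ℕ
    additive : Additive σ
    σ-swap   : ∀ {B : Set} {τ : (B → ℕ) → ℕ} → Additive τ → (f : A → B → ℕ) →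
               σ (λ a → τ (f a)) ≡ τ (λ b → σ (λ a → f a b))
    term≤σ   : ∀ f a → f a ≤ σ f
    size     : ℕ
    σ-1      : σ (λ _ → 1) ≡ size
  open Additive additive public

  count : {P : A → Set} → (∀ a → Dec (P a)) → ℕ
  count P? = σ (λ a → 𝟙 (P? a))

  σ-scale : ∀ c f → σ (λ a → c * f a) ≡ c * σ f
  σ-scale zero    f = σ-0
  σ-scale (suc c) f = trans (σ-+ f (λ a → c * f a)) (cong (σ f +_) (σ-scale c f))

  σ-const : ∀ c → σ (λ _ → c) ≡ size * c
  σ-const c = begin
    σ (λ _ → c)      ≡⟨ σ-cong (λ _ → sym (*-identityʳ c)) ⟩
    σ (λ _ → c * 1)  ≡⟨ σ-scale c (λ _ → 1) ⟩
    c * σ (λ _ → 1)  ≡⟨ cong (c *_) σ-1 ⟩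
    c * size         ≡⟨ *-comm c size ⟩
    size * c         ∎
    where open ≡-Reasoning

  -- Monotonicity follows from additivity: g = f + (g ∸ f) pointwise.
  σ-mono : ∀ {f g} → (∀ a → f a ≤ g a) → σ f ≤ σ g
  σ-mono {f} {g} f≤g = begin
    σ f                               ≤⟨ m≤m+n (σ f) _ ⟩
    σ f + σ (λ a → g a ∸ f a)         ≡⟨ σ-+ f _ ⟨
    σ (λ a → f a + (g a ∸ f a))       ≡⟨ σ-cong (λ a → m+[n∸m]≡n (f≤g a)) ⟩
    σ g                               ∎
    where open ≤-Reasoning

  count-empty : {P : A → Set} (P? : ∀ a → Dec (P a)) → (∀ a → ¬ P a) → count P? ≡ 0
  count-empty P? ¬P = trans (σ-cong (λ a → 𝟙-false (P? a) (¬P a))) σ-0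

boolSum : FinSum Bool
boolSum = record
  { σ        = λ f → f true + f false
  ; additive = record
    { σ-cong = λ f≗g → cong₂ _+_ (f≗g true) (f≗g false)
    ; σ-+    = λ f g → +-interchange (f true) (g true) (f false) (g false)
    ; σ-0    = refl }
  ; σ-swap   = λ τ f → sym (Additive.σ-+ τ (f true) (f false))
  ; term≤σ   = λ { f true  → m≤m+n (f true) (f false)
                 ; f false → m≤n+m (f false) (f true) }
  ; size     = 2
  ; σ-1      = refl }

finSum : ∀ m → FinSum (Fin m)
finSum m = record
  { σ        = σF m
  ; additive = record { σ-cong = cong-F m ; σ-+ = +-F m ; σ-0 = 0-F m }
  ; σ-swap   = swap-F m
  ; term≤σ   = term-F m
  ; size     = m
  ; σ-1      = 1-F m }
  where
  σF : ∀ m → (Fin m → ℕ) → ℕ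
  σF zero    f = 0
  σF (suc m) f = f zero + σF m (λ i → f (suc i))

  cong-F : ∀ m {f g : Fin m → ℕ} → (∀ i → f i ≡ g i) → σF m f ≡ σF m g
  cong-F zero    f≗g = refl
  cong-F (suc m) f≗g = cong₂ _+_ (f≗g zero) (cong-F m (λ i → f≗g (suc i)))

  +-F : ∀ m f g → σF m (λ i → f i + g i) ≡ σF m f + σF m g
  +-F zero    f g = refl
  +-F (suc m) f g = trans (cong (f zero + g zero +_) (+-F m _ _))
                          (+-interchange (f zero) (g zero) _ _)

  0-F : ∀ m → σF m (λ _ → 0) ≡ 0
  0-F zero    = refl
  0-F (suc m) = 0-F m

  swap-F : ∀ m {B : Set} {τ : (B → ℕ) → ℕ} → Additive τ → (f : Fin m → B → ℕ) →
           σF m (λ i → τ (f i)) ≡ τ (λ b → σF m (λ i → f i b))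
  swap-F zero    τ f = sym (Additive.σ-0 τ)
  swap-F (suc m) τ f = trans (cong (_ +_) (swap-F m τ (λ i → f (suc i))))
                             (sym (Additive.σ-+ τ (f zero) _))

  term-F : ∀ m f i → f i ≤ σF m f
  term-F (suc m) f zero    = m≤m+n _ _
  term-F (suc m) f (suc i) = ≤-trans (term-F m (λ k → f (suc k)) i) (m≤n+m _ _)

  1-F : ∀ m → σF m (λ _ → 1) ≡ m
  1-F zero    = refl
  1-F (suc m) = cong suc (1-F m)

σVec : {A : Set} → ((A → ℕ) → ℕ) → ∀ n → (Vec A n → ℕ) → ℕ
σVec σ zero    f = f []
σVec σ (suc n) f = σ (λ a → σVec σ n (λ v → f (a ∷ v)))

module _ {A : Set} (S : FinSum A) where
  open FinSum S

  additive-Vec : ∀ n → Additive (σVec σ n)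
  additive-Vec n = record { σ-cong = cong-V n ; σ-+ = +-V n ; σ-0 = 0-V n }
    where
    cong-V : ∀ n {f g : Vec A n → ℕ} → (∀ v → f v ≡ g v) → σVec σ n f ≡ σVec σ n g
    cong-V zero    f≗g = f≗g []
    cong-V (suc n) f≗g = σ-cong (λ a → cong-V n (λ v → f≗g (a ∷ v)))

    +-V : ∀ n f g → σVec σ n (λ v → f v + g v) ≡ σVec σ n f + σVec σ n g
    +-V zero    f g = refl
    +-V (suc n) f g = trans (σ-cong (λ a → +-V n _ _)) (σ-+ _ _)

    0-V : ∀ n → σVec σ n (λ _ → 0) ≡ 0
    0-V zero    = refl
    0-V (suc n) = trans (σ-cong (λ a → 0-V n)) σ-0

  vecSum : ∀ n → FinSum (Vec A n)
  vecSum n = record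
    { σ        = σVec σ n
    ; additive = additive-Vec n
    ; σ-swap   = swap-V n
    ; term≤σ   = term-V n
    ; size     = size ^ n
    ; σ-1      = 1-V n }
    where
    swap-V : ∀ n {B : Set} {τ : (B → ℕ) → ℕ} → Additive τ → (f : Vec A n → B → ℕ) →
             σVec σ n (λ v → τ (f v)) ≡ τ (λ b → σVec σ n (λ v → f v b))
    swap-V zero    τ f = refl
    swap-V (suc n) τ f =
      trans (σ-cong (λ a → swap-V n τ (λ v → f (a ∷ v)))) (σ-swap τ _)

    term-V : ∀ n f v → f v ≤ σVec σ n f
    term-V zero    f []      = ≤-refl
    term-V (suc n) f (a ∷ v) =
      ≤-trans (term-V n (λ w → f (a ∷ w)) v)
              (term≤σ (λ x → σVec σ n (λ w → f (x ∷ w))) a)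

    1-V : ∀ n → σVec σ n (λ _ → 1) ≡ size ^ n
    1-V zero    = refl
    1-V (suc n) = trans (σ-cong (λ a → 1-V n)) (σ-const (size ^ n))

record BooleanGroup (A : Set) : Set where
  infixl 6 _∙_
  field
    _∙_         : A → A → A
    ε           : A
    ∙-assoc     : ∀ x y z → (x ∙ y) ∙ z ≡ x ∙ (y ∙ z)
    ∙-comm      : ∀ x y → x ∙ y ≡ y ∙ x
    ∙-identityʳ : ∀ x → x ∙ ε ≡ x
    ∙-self      : ∀ x → x ∙ x ≡ ε

  ∙-identityˡ : ∀ x → ε ∙ x ≡ x
  ∙-identityˡ x = trans (∙-comm ε x) (∙-identityʳ x)

  ∙-interchange : ∀ x y u v → (x ∙ y) ∙ (u ∙ v) ≡ (x ∙ u) ∙ (y ∙ v)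
  ∙-interchange x y u v = begin
    (x ∙ y) ∙ (u ∙ v)  ≡⟨ ∙-assoc x y (u ∙ v) ⟩
    x ∙ (y ∙ (u ∙ v))  ≡⟨ cong (x ∙_) (∙-assoc y u v) ⟨
    x ∙ ((y ∙ u) ∙ v)  ≡⟨ cong (λ z → x ∙ (z ∙ v)) (∙-comm y u) ⟩
    x ∙ ((u ∙ y) ∙ v)  ≡⟨ cong (x ∙_) (∙-assoc u y v) ⟩
    x ∙ (u ∙ (y ∙ v))  ≡⟨ ∙-assoc x u (y ∙ v) ⟨
    (x ∙ u) ∙ (y ∙ v)  ∎
    where open ≡-Reasoning

  ∙-fixes⇔ε : ∀ x y → x ∙ y ≡ y ⇔ x ≡ ε
  ∙-fixes⇔ε x y = mk⇔ to (λ { refl → ∙-identityˡ y })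
    where
    open ≡-Reasoning
    to : x ∙ y ≡ y → x ≡ ε
    to xy≡y = begin
      x            ≡⟨ ∙-identityʳ x ⟨
      x ∙ ε        ≡⟨ cong (x ∙_) (∙-self y) ⟨
      x ∙ (y ∙ y)  ≡⟨ ∙-assoc x y y ⟨
      (x ∙ y) ∙ y  ≡⟨ cong (_∙ y) xy≡y ⟩
      y ∙ y        ≡⟨ ∙-self y ⟩
      ε            ∎

xorGroup : BooleanGroup Bool
xorGroup = record
  { _∙_ = _xor_ ; ε = false
  ; ∙-assoc = xor-assoc ; ∙-comm = xor-comm
  ; ∙-identityʳ = xor-identityʳ ; ∙-self = xor-same }

vecGroup : {A : Set} → BooleanGroup A → ∀ n → BooleanGroup (Vec A n)
vecGroup G n = record
  { _∙_         = zipWith _∙_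
  ; ε           = replicate n ε
  ; ∙-assoc     = zipWith-assoc ∙-assoc
  ; ∙-comm      = zipWith-comm ∙-comm
  ; ∙-identityʳ = zipWith-identityʳ ∙-identityʳ
  ; ∙-self      = λ v → trans (cong (zipWith _∙_ v) (sym (map-id v)))
                              (zipWith-inverseʳ ∙-self v) }
  where open BooleanGroup G

record FiniteBooleanGroup (A : Set) : Set₁ where
  field
    group : BooleanGroup A
    sum   : FinSum A
    _≟_   : DecidableEquality A
  open BooleanGroup group public
  open FinSum sum public
  field
    σ-translate : ∀ f d → σ (λ a → f (a ∙ d)) ≡ σ f
    σ-point     : ∀ w → σ (λ a → 𝟙 (w ≟ a)) ≡ 1

F₂ : FiniteBooleanGroup Bool
F₂ = record
  { group       = xorGroup
  ; sum         = boolSum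
  ; _≟_         = Data.Bool._≟_
  ; σ-translate = λ { f false → refl ; f true → +-comm (f false) (f true) }
  ; σ-point     = λ { true → refl ; false → refl } }

power : {A : Set} → FiniteBooleanGroup A → ∀ n → FiniteBooleanGroup (Vec A n)
power {A} G n = record
  { group       = vecGroup group n
  ; sum         = vecSum sum n
  ; _≟_         = ≡-dec _≟_
  ; σ-translate = translate-V n
  ; σ-point     = point-V n }
  where
  open FiniteBooleanGroup G

  translate-V : ∀ n f (d : Vec A n) → σVec σ n (λ v → f (zipWith _∙_ v d)) ≡ σVec σ n f
  translate-V zero    f []       = refl
  translate-V (suc n) f (d ∷ ds) =
    trans (σ-cong (λ a → translate-V n (λ w → f ((a ∙ d) ∷ w)) ds))
          (σ-translate (λ x → σVec σ n (λ v → f (x ∷ v))) d)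

  𝟙-∷ : ∀ {n} (w a : A) (ws v : Vec A n) →
        𝟙 (≡-dec _≟_ (w ∷ ws) (a ∷ v)) ≡ 𝟙 (w ≟ a) * 𝟙 (≡-dec _≟_ ws v)
  𝟙-∷ w a ws v with w ≟ a
  ... | yes _ = sym (+-identityʳ _)
  ... | no  _ = refl

  point-V : ∀ n (w : Vec A n) → σVec σ n (λ v → 𝟙 (≡-dec _≟_ w v)) ≡ 1
  point-V zero    []       = refl
  point-V (suc n) (w ∷ ws) = begin
    σ (λ a → σVec σ n (λ v → 𝟙 (≡-dec _≟_ (w ∷ ws) (a ∷ v))))
      ≡⟨ σ-cong (λ a → Additive.σ-cong (additive-Vec sum n) (λ v → 𝟙-∷ w a ws v)) ⟩
    σ (λ a → σVec σ n (λ v → 𝟙 (w ≟ a) * 𝟙 (≡-dec _≟_ ws v)))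
      ≡⟨ σ-cong (λ a → FinSum.σ-scale (vecSum sum n) (𝟙 (w ≟ a)) _) ⟩
    σ (λ a → 𝟙 (w ≟ a) * σVec σ n (λ v → 𝟙 (≡-dec _≟_ ws v)))
      ≡⟨ σ-cong (λ a → trans (cong (𝟙 (w ≟ a) *_) (point-V n ws)) (*-identityʳ _)) ⟩
    σ (λ a → 𝟙 (w ≟ a))
      ≡⟨ σ-point w ⟩
    1 ∎
    where open ≡-Reasoning

-- Counting with a surjective homomorphism φ : X → Y: every fibre φ⁻¹(y)
-- is a translate of the kernel, so |Y| · |ker φ| = |X|.
kernel-size : {A B : Set} (GX : FiniteBooleanGroup A) (GY : FiniteBooleanGroup B) →
  let module X = FiniteBooleanGroup GX
      module Y = FiniteBooleanGroup GY in
  (φ : A → B) → (∀ x d → φ (x X.∙ d) ≡ φ x Y.∙ φ d) → (∀ y → ∃ λ d → φ d ≡ y) →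
  Y.size * X.count (λ x → φ x Y.≟ Y.ε) ≡ X.size
kernel-size {A} {B} GX GY φ hom surj = sym (begin
  X.size
    ≡⟨ X.σ-1 ⟨
  X.σ (λ _ → 1)
    ≡⟨ X.σ-cong (λ x → Y.σ-point (φ x)) ⟨
  X.σ (λ x → Y.σ (λ y → 𝟙 (φ x Y.≟ y)))
    ≡⟨ X.σ-swap Y.additive _ ⟩
  Y.σ (λ y → X.σ (λ x → 𝟙 (φ x Y.≟ y)))
    ≡⟨ Y.σ-cong (λ y → X.σ-translate _ (pre y)) ⟨
  Y.σ (λ y → X.σ (λ x → 𝟙 (φ (x X.∙ pre y) Y.≟ y)))
    ≡⟨ Y.σ-cong (λ y → X.σ-cong (fibre y)) ⟩
  Y.σ (λ _ → X.count (λ x → φ x Y.≟ Y.ε))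
    ≡⟨ Y.σ-const _ ⟩
  Y.size * X.count (λ x → φ x Y.≟ Y.ε) ∎)
  where
  open ≡-Reasoning
  module X = FiniteBooleanGroup GX
  module Y = FiniteBooleanGroup GY

  pre : B → A
  pre y = proj₁ (surj y)

  fibre : ∀ y x → 𝟙 (φ (x X.∙ pre y) Y.≟ y) ≡ 𝟙 (φ x Y.≟ Y.ε)
  fibre y x = 𝟙-⇔ (mk⇔ (to ∘ trans (sym shift)) (trans shift ∘ from))
                  (φ (x X.∙ pre y) Y.≟ y) (φ x Y.≟ Y.ε)
    where
    open Equivalence (Y.∙-fixes⇔ε (φ x) y)
    shift : φ (x X.∙ pre y) ≡ φ x Y.∙ y
    shift = trans (hom x (pre y)) (cong (φ x Y.∙_) (proj₂ (surj y)))

covering-bound : {A B : Set} (SX : FinSum A) (SL : FinSum B) {P : B → A → Set}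
  (P? : ∀ l x → Dec (P l x)) (K : ℕ) → 0 < FinSum.size SX →
  (∀ x → ∃ λ l → P l x) →
  (∀ l → K * FinSum.count SX (P? l) ≤ FinSum.size SX) →
  K ≤ FinSum.size SL
covering-bound SX SL P? K |X|>0 cover small =
  *-cancelʳ-≤ K L.size X.size {{>-nonZero |X|>0}} (begin
    K * X.size                              ≡⟨ cong (K *_) X.σ-1 ⟨
    K * X.σ (λ _ → 1)                       ≤⟨ *-monoʳ-≤ K (X.σ-mono covered) ⟩
    K * X.σ (λ x → L.σ (λ l → 𝟙 (P? l x)))  ≡⟨ cong (K *_) (X.σ-swap L.additive _) ⟩
    K * L.σ (λ l → X.count (P? l))          ≡⟨ L.σ-scale K _ ⟨
    L.σ (λ l → K * X.count (P? l))          ≤⟨ L.σ-mono small ⟩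
    L.σ (λ _ → X.size)                      ≡⟨ L.σ-const X.size ⟩
    L.size * X.size                         ∎)
  where
  open ≤-Reasoning
  module X = FinSum SX
  module L = FinSum SL

  covered : ∀ x → 1 ≤ L.σ (λ l → 𝟙 (P? l x))
  covered x = let (l , p) = cover x in
    subst (_≤ L.σ _) (𝟙-true (P? l x) p) (L.term≤σ (λ l → 𝟙 (P? l x)) l)

-- C₂^r as a finite Boolean group; its operation is Defs' _⊕_ and its
-- neutral element is 𝟘, definitionally.
C₂^ : ∀ r → FiniteBooleanGroup (C2^ r)
C₂^ r = power F₂ r

lookup-ext : {A : Set} {n : ℕ} (u v : Vec A n) → (∀ i → lookup u i ≡ lookup v i) → u ≡ v
lookup-ext u v u≗v =
  trans (sym (tabulate∘lookup u)) (trans (tabulate-cong u≗v) (tabulate∘lookup v))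

does-true : {P : Set} (p : Dec P) → does p ≡ true → P
does-true (yes p) _ = p

module _ {r : ℕ} where
  open FiniteBooleanGroup (C₂^ r) using (∙-self; ∙-identityˡ; ∙-identityʳ; ∙-interchange)

  subsum-cong : ∀ {n} (s t : Seq r n) (P : Subset n) →
    (∀ k → lookup P k ≡ true → s k ≡ t k) → subsum s P ≡ subsum t P
  subsum-cong {zero}  s t []          agree = refl
  subsum-cong {suc n} s t (true  ∷ P) agree =
    cong₂ _⊕_ (agree zero refl) (subsum-cong _ _ P (agree ∘ suc))
  subsum-cong {suc n} s t (false ∷ P) agree = subsum-cong _ _ P (agree ∘ suc)

  subsum-⊕ : ∀ {n} (s t : Seq r n) (P : Subset n) →
    subsum (λ k → s k ⊕ t k) P ≡ subsum s P ⊕ subsum t P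
  subsum-⊕ {zero}  s t []          = sym (∙-self 𝟘)
  subsum-⊕ {suc n} s t (true  ∷ P) =
    trans (cong ((s zero ⊕ t zero) ⊕_) (subsum-⊕ _ _ P))
          (∙-interchange (s zero) (t zero) _ _)
  subsum-⊕ {suc n} s t (false ∷ P) = subsum-⊕ _ _ P

  subsum-𝟘 : ∀ {n} (P : Subset n) → subsum {r} (λ _ → 𝟘) P ≡ 𝟘
  subsum-𝟘 []          = refl
  subsum-𝟘 (true  ∷ P) = trans (∙-identityˡ _) (subsum-𝟘 P)
  subsum-𝟘 (false ∷ P) = subsum-𝟘 P

  point : ∀ {n} → Fin n → C2^ r → Seq r n
  point d x k = if does (d Fin.≟ k) then x else 𝟘

  subsum-point : ∀ {n} (d : Fin n) (x : C2^ r) (P : Subset n) →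
    subsum (point d x) P ≡ (if lookup P d then x else 𝟘)
  subsum-point zero    x (true  ∷ P) = trans (cong (x ⊕_) (subsum-𝟘 P)) (∙-identityʳ x)
  subsum-point zero    x (false ∷ P) = subsum-𝟘 P
  subsum-point (suc d) x (true  ∷ P) = trans (∙-identityˡ _) (subsum-point d x P)
  subsum-point (suc d) x (false ∷ P) = subsum-point d x P

-- A labelling of n positions with j classes: label zero means "unused",
-- label suc i puts the position into the i-th class.
Labelling : ℕ → ℕ → Set
Labelling j n = Vec (Fin (suc j)) n

class : ∀ {j n} → Labelling j n → Fin j → Subset n
class T i = Data.Vec.map (λ t → does (t Fin.≟ suc i)) T

∈-class : ∀ {j n} (T : Labelling j n) i k →
  lookup (class T i) k ≡ true → lookup T k ≡ suc i
∈-class T i k k∈ = does-true (lookup T k Fin.≟ suc i) (trans (sym (lookup-map k _ T)) k∈)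

Full : ∀ {j n} → Labelling j n → Set
Full {j} T = ∀ (i : Fin j) → ∃ λ k → lookup T k ≡ suc i

full? : ∀ {j n} (T : Labelling j n) → Dec (Full T)
full? T = Fin.all? (λ i → Fin.any? (λ k → lookup T k Fin.≟ suc i))

classSums : ∀ {j r n} → Labelling j n → Vec (C2^ r) n → Vec (C2^ r) j
classSums T s = tabulate (λ i → subsum (lookup s) (class T i))

classSums-⊕ : ∀ {j r n} (T : Labelling j n) (s t : Vec (C2^ r) n) →
  classSums T (zipWith _⊕_ s t) ≡ zipWith _⊕_ (classSums T s) (classSums T t)
classSums-⊕ T s t = lookup-ext _ _ λ i → begin
  lookup (classSums T (zipWith _⊕_ s t)) i
    ≡⟨ lookup∘tabulate _ i ⟩
  subsum (lookup (zipWith _⊕_ s t)) (class T i)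
    ≡⟨ subsum-cong _ _ (class T i) (λ k _ → lookup-zipWith _⊕_ k s t) ⟩
  subsum (λ k → lookup s k ⊕ lookup t k) (class T i)
    ≡⟨ subsum-⊕ (lookup s) (lookup t) (class T i) ⟩
  subsum (lookup s) (class T i) ⊕ subsum (lookup t) (class T i)
    ≡⟨ cong₂ _⊕_ (lookup∘tabulate _ i) (lookup∘tabulate _ i) ⟨
  lookup (classSums T s) i ⊕ lookup (classSums T t) i
    ≡⟨ lookup-zipWith _⊕_ i (classSums T s) (classSums T t) ⟨
  lookup (zipWith _⊕_ (classSums T s) (classSums T t)) i ∎
  where open ≡-Reasoning

-- For a full labelling every vector v of class sums is attained: put v_i
-- at a chosen representative of class i and 𝟘 everywhere else.
classSums-onto : ∀ {j r n} (T : Labelling j n) → Full T →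
  ∀ (v : Vec (C2^ r) j) → ∃ λ s → classSums T s ≡ v
classSums-onto {j} {r} {n} T full v = preimage , lookup-ext _ _ sums
  where
  open ≡-Reasoning
  rep : Fin j → Fin n
  rep i = proj₁ (full i)

  value : Fin (suc j) → Fin n → C2^ r
  value zero    k = 𝟘
  value (suc i) k = point (rep i) (lookup v i) k

  preimage : Vec (C2^ r) n
  preimage = tabulate (λ k → value (lookup T k) k)

  sums : ∀ i → lookup (classSums T preimage) i ≡ lookup v i
  sums i = begin
    lookup (classSums T preimage) i
      ≡⟨ lookup∘tabulate _ i ⟩
    subsum (lookup preimage) (class T i)
      ≡⟨ subsum-cong _ _ (class T i) on-class ⟩
    subsum (point (rep i) (lookup v i)) (class T i)
      ≡⟨ subsum-point (rep i) (lookup v i) (class T i) ⟩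
    (if lookup (class T i) (rep i) then lookup v i else 𝟘)
      ≡⟨ cong (if_then lookup v i else 𝟘) rep∈class ⟩
    lookup v i ∎
    where
    on-class : ∀ k → lookup (class T i) k ≡ true →
               lookup preimage k ≡ point (rep i) (lookup v i) k
    on-class k k∈ = trans (lookup∘tabulate _ k) (cong (λ t → value t k) (∈-class T i k k∈))

    rep∈class : lookup (class T i) (rep i) ≡ true
    rep∈class = trans (lookup-map _ _ T) (dec-true (_ Fin.≟ suc i) (proj₂ (full i)))

does-∈? : ∀ {n} (k : Fin n) (P : Subset n) → does (k ∈? P) ≡ lookup P k
does-∈? zero    (true  ∷ P) = refl
does-∈? zero    (false ∷ P) = refl
does-∈? (suc k) (b     ∷ P) = does-∈? k P

-- j pairwise disjoint non-empty zero-sum subsequences of s give a full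
-- labelling whose class sums vanish: label each position by the
-- (unique) subsequence containing it, if any.
labelling-of : ∀ {j r n} (s : Vec (C2^ r) n) → HasDisjointZeroSums j (lookup s) →
  ∃ λ (T : Labelling j n) → Full T × classSums T s ≡ replicate j 𝟘
labelling-of {j} {n = n} s (S , nonempty , zero-sum , disjoint) =
  T , (λ i → let (k , k∈) = nonempty i in k , label⇔∈ k i .from k∈) , sums-vanish
  where
  open Equivalence

  labelOf : ∀ {k} → Dec (∃ λ i → k ∈ S i) → Fin (suc j)
  labelOf (yes (i , _)) = suc i
  labelOf (no _)        = zero

  T : Labelling j n
  T = tabulate (λ k → labelOf (Fin.any? (λ i → k ∈? S i)))

  unique : ∀ {k i i′} → k ∈ S i → k ∈ S i′ → i ≡ i′
  unique {k} {i} {i′} k∈i k∈i′ with i Fin.≟ i′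
  ... | yes i≡i′ = i≡i′
  ... | no  i≢i′ = contradiction (k , x∈p∩q⁺ (k∈i , k∈i′)) (disjoint i i′ i≢i′)

  label⇔∈ : ∀ k i → lookup T k ≡ suc i ⇔ k ∈ S i
  label⇔∈ k i rewrite lookup∘tabulate (λ k → labelOf (Fin.any? (λ i → k ∈? S i))) k
    with Fin.any? (λ i → k ∈? S i)
  ... | yes (i′ , k∈i′) = mk⇔ (λ { refl → k∈i′ }) (λ k∈i → cong suc (unique k∈i′ k∈i))
  ... | no  k∉         = mk⇔ (λ ()) (λ k∈i → contradiction (i , k∈i) k∉)

  class≡S : ∀ i → class T i ≡ S i
  class≡S i = lookup-ext _ _ λ k → begin
    lookup (class T i) k           ≡⟨ lookup-map k _ T ⟩
    does (lookup T k Fin.≟ suc i)  ≡⟨ does-⇔ (label⇔∈ k i) (lookup T k Fin.≟ suc i) (k ∈? S i) ⟩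
    does (k ∈? S i)                ≡⟨ does-∈? k (S i) ⟩
    lookup (S i) k                 ∎
    where open ≡-Reasoning

  sums-vanish : classSums T s ≡ replicate j 𝟘
  sums-vanish = lookup-ext _ _ λ i → begin
    lookup (classSums T s) i       ≡⟨ lookup∘tabulate _ i ⟩
    subsum (lookup s) (class T i)  ≡⟨ cong (subsum (lookup s)) (class≡S i) ⟩
    subsum (lookup s) (S i)        ≡⟨ zero-sum i ⟩
    𝟘                              ≡⟨ lookup-replicate i 𝟘 ⟨
    lookup (replicate j 𝟘) i       ∎
    where open ≡-Reasoning

-- The
-- kernels of the surjective homomorphisms classSums T (T full) cover
-- all sequences, there are at most (j+1)^n of them, and each has
-- 2^(rn) / 2^(rj) elements.
counting-bound : ∀ j r n → (∀ (s : Vec (C2^ r) n) → HasDisjointZeroSums j (lookup s)) →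
  (2 ^ r) ^ j ≤ suc j ^ n
counting-bound j r n every =
  covering-bound Seqs.sum (vecSum (finSum (suc j)) n) P? ((2 ^ r) ^ j)
    (m^n>0 (2 ^ r) {{m^n≢0 2 r}} n) covered small
  where
  module Seqs = FiniteBooleanGroup (power (C₂^ r) n)
  module Sums = FiniteBooleanGroup (power (C₂^ r) j)

  P? : ∀ T s → Dec (Full T × classSums T s ≡ Sums.ε)
  P? T s = full? T ×-dec (classSums T s Sums.≟ Sums.ε)

  covered : ∀ s → ∃ λ T → Full T × classSums T s ≡ Sums.ε
  covered s = labelling-of s (every s)

  small : ∀ T → (2 ^ r) ^ j * Seqs.count (P? T) ≤ Seqs.size
  small T with full? T
  ... | no unused = begin
    (2 ^ r) ^ j * Seqs.count (P? T)
      ≡⟨ cong ((2 ^ r) ^ j *_) (Seqs.count-empty (P? T) (λ _ → unused ∘ proj₁)) ⟩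
    (2 ^ r) ^ j * 0
      ≡⟨ *-zeroʳ ((2 ^ r) ^ j) ⟩
    0
      ≤⟨ z≤n ⟩
    Seqs.size ∎
    where open ≤-Reasoning
  ... | yes used  = begin
    (2 ^ r) ^ j * Seqs.count (P? T)
      ≤⟨ *-monoʳ-≤ ((2 ^ r) ^ j) (Seqs.σ-mono λ s →
           𝟙-mono proj₂ (P? T s) (classSums T s Sums.≟ Sums.ε)) ⟩
    (2 ^ r) ^ j * Seqs.count (λ s → classSums T s Sums.≟ Sums.ε)
      ≡⟨ kernel-size (power (C₂^ r) n) (power (C₂^ r) j) (classSums T)
           (classSums-⊕ T) (classSums-onto T used) ⟩
    Seqs.size ∎
    where open ≤-Reasoning

-- Comparing exponents: (j+1)^a < 2^(jb) and 2^(rj) ≤ (j+1)^ℓ force ar ≤ bℓ,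
-- since otherwise (j+1)^(ar) < 2^(jbr) ≤ (j+1)^(ℓb) ≤ (j+1)^(ar).
exponent-comparison : ∀ j a b r ℓ →
  suc j ^ a < 2 ^ (j * b) → (2 ^ r) ^ j ≤ suc j ^ ℓ → a * r ≤ b * ℓ
exponent-comparison j a b zero    ℓ _ _ = ≤-trans (≤-reflexive (*-zeroʳ a)) z≤n
exponent-comparison j a b r@(suc _) ℓ small bound =
  ≮⇒≥ λ bℓ<ar → <-irrefl refl (begin-strict
      suc j ^ (a * r)     ≡⟨ ^-*-assoc (suc j) a r ⟨
      (suc j ^ a) ^ r     <⟨ ^-monoˡ-< r small ⟩
      (2 ^ (j * b)) ^ r   ≡⟨ ^-*-assoc 2 (j * b) r ⟩
      2 ^ (j * b * r)     ≡⟨ cong (2 ^_) (*-comm (j * b) r) ⟩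
      2 ^ (r * (j * b))   ≡⟨ ^-*-assoc 2 r (j * b) ⟨
      (2 ^ r) ^ (j * b)   ≡⟨ ^-*-assoc (2 ^ r) j b ⟨
      ((2 ^ r) ^ j) ^ b   ≤⟨ ^-monoˡ-≤ b bound ⟩
      (suc j ^ ℓ) ^ b     ≡⟨ ^-*-assoc (suc j) ℓ b ⟩
      suc j ^ (ℓ * b)     ≤⟨ ^-monoʳ-≤ (suc j) (≤-trans (≤-reflexive (*-comm ℓ b)) (<⇒≤ bℓ<ar)) ⟩
      suc j ^ (a * r)     ∎)
  where open ≤-Reasoning

-- Proposition 7: whenever (j+1)^a < 2^(jb), i.e. a/b < log 2 · j / log(j+1),
-- the bound a·r ≤ b·D_j(C₂^r) holds for every r (so R = 0 works).
proposition7 : (j : ℕ) → 1 ≤ j →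
    (a b : ℕ) → 0 < b → suc j ^ a < 2 ^ (j * b) →
    ∃ λ R → (r : ℕ) → R ≤ r → (ℓ : ℕ) → IsDj j r ℓ → a * r ≤ b * ℓ
proposition7 j _ a b _ small = 0 , λ r _ ℓ (good , _) →
  exponent-comparison j a b r ℓ small
    (counting-bound j r ℓ (λ s → good ℓ ≤-refl (lookup s)))
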